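{- For each $\mathcal{C}\in\{\mathrm{Horn},\mathrm{dHorn},\mathrm{Krom}\}$, the parameter $\mathrm{depth}_{\mathcal{C}}$ strictly dominates $\mathrm{depth}_{\mathrm{Null}}$.
   Context: A clause is a finite set of literals with no complementary pair; a CNF formula is a finite set of clauses. For a partial assignment $\tau$, $F[\tau]$ is obtained by deleting clauses containing a true literal and deleting false literals from the remaining clauses. $\mathrm{Conn}(F)$ is the set of connected components of $F$ with respect to its incidence graph (bipartite graph between variables and clauses, $x$ adjacent to $c$ iff $x$ or $\neg x$ is in $c$). Horn: every clause has at most one positive literal; dHorn: every clause has at most one negative literal; Krom: every clause has at most two literals; Null: the class of CNF formulas containing no variables. $\mathrm{depth}_{\mathcal{C}}(F)$ is $0$ if $F\in\mathcal{C}$; if $F\notin\mathcal{C}$ and $F$ is connected it is $1+\min_{x\in\mathit{var}(F)}\max_{\epsilon\in\{0,1\}}\mathrm{depth}_{\mathcal{C}}(F[x=\epsilon])$; otherwise it is $\max_{F'\in\mathrm{Conn}(F)}\mathrm{depth}_{\mathcal{C}}(F')$. For integer-valued parameters $p,q$: $p$ dominates $q$ if every class of formulas on which $q$ is bounded also has $p$ bounded; $p$ strictly dominates $q$ if $p$ dominates $q$ but $q$ does not dominate $p$. -}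

module Defs where

open import Data.Nat using (ℕ; zero; suc; _≤_; _≡ᵇ_)
open import Data.Bool using (Bool; true; false; not; _∧_; if_then_else_)
open import Data.Product using (Σ; ∃; _×_; _,_)
open import Data.List using (List; []; _∷_; length; concatMap)
open import Data.List.Membership.Propositional using (_∈_)
open import Data.List.Relation.Unary.All using (All)
open import Data.List.Relation.Unary.Unique.Propositional using (Unique)
open import Relation.Binary.PropositionalEquality using (_≡_)
open import Relation.Binary.Construct.Closure.ReflexiveTransitive using (Star)
open import Relation.Nullary using (¬_)
open import Function.Bundles using (_⇔_)

-- Variables are natural numbers; a literal is a variable with a
-- sign (true = positive literal x, false = negative literal ¬x).
-- Clauses and formulas are finite sets, represented by lists; the
-- well-formedness predicate WF below demands that clauses contain no
-- repeated literal and no complementary pair.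

record Literal : Set where
  constructor lit
  field
    var  : ℕ
    sign : Bool
open Literal public

Clause : Set
Clause = List Literal

Formula : Set
Formula = List Clause

NoComplementaryPair : Clause → Set
NoComplementaryPair c = ∀ x → ¬ (lit x true ∈ c × lit x false ∈ c)

WFClause : Clause → Set
WFClause c = Unique c × NoComplementaryPair c

WF : Formula → Set
WF F = All WFClause F

varsC : Clause → List ℕ
varsC [] = []
varsC (l ∷ c) = var l ∷ varsC c

vars : Formula → List ℕ
vars F = concatMap varsC F

_==B_ : Bool → Bool → Bool
true  ==B b = b
false ==B b = not b

satisfiedBy : ℕ → Bool → Clause → Bool
satisfiedBy x ε [] = false
satisfiedBy x ε (l ∷ c) =
  if (var l ≡ᵇ x) ∧ (sign l ==B ε) then true else satisfiedBy x ε c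

dropVar : ℕ → Clause → Clause
dropVar x [] = []
dropVar x (l ∷ c) = if var l ≡ᵇ x then dropVar x c else l ∷ dropVar x c

_[_≔_] : Formula → ℕ → Bool → Formula
[] [ x ≔ ε ] = []
(c ∷ F) [ x ≔ ε ] =
  if satisfiedBy x ε c then F [ x ≔ ε ] else dropVar x c ∷ (F [ x ≔ ε ])

-- two clauses are adjacent via a common variable (path clause–var–clause)
SharesVar : Clause → Clause → Set
SharesVar c d = ∃ λ x → x ∈ varsC c × x ∈ varsC d

Step : Formula → Clause → Clause → Set
Step F c d = c ∈ F × d ∈ F × SharesVar c d

Reach : Formula → Clause → Clause → Set
Reach F = Star (Step F)

-- the incidence graph of F is connected (every variable of F lies in a
-- clause of F, so clause-to-clause reachability suffices)
Connected : Formula → Set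
Connected F = ∀ c d → c ∈ F → d ∈ F → Reach F c d

IsComponent : Formula → Formula → Set
IsComponent F G = Σ Clause λ c → c ∈ F × (∀ d → d ∈ G ⇔ (d ∈ F × Reach F c d))

Class : Set₁
Class = Formula → Set

countPos : Clause → ℕ
countPos [] = 0
countPos (l ∷ c) = if sign l then suc (countPos c) else countPos c

countNeg : Clause → ℕ
countNeg [] = 0
countNeg (l ∷ c) = if sign l then countNeg c else suc (countNeg c)

Horn : Class
Horn F = All (λ c → countPos c ≤ 1) F

dHorn : Class
dHorn F = All (λ c → countNeg c ≤ 1) F

Krom : Class
Krom F = All (λ c → length c ≤ 2) F

Null : Class
Null F = All (λ c → c ≡ []) F

-- depth_C. Depth≤ C k F holds iff depth_C(F) ≤ k, by the inductive
-- reading of the recursive definition.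

data Depth≤ (C : Class) : ℕ → Formula → Set where
  base   : ∀ {k F} → C F → Depth≤ C k F
  branch : ∀ {k F} (x : ℕ) → ¬ C F → Connected F → x ∈ vars F →
           Depth≤ C k (F [ x ≔ false ]) → Depth≤ C k (F [ x ≔ true ]) →
           Depth≤ C (suc k) F
  split  : ∀ {k F} → ¬ C F → ¬ Connected F →
           (∀ G → IsComponent F G → Depth≤ C k G) → Depth≤ C k F

BoundedOn : Class → (Formula → Set) → Set
BoundedOn C P = ∃ λ k → ∀ F → WF F → P F → Depth≤ C k F

Dominates : Class → Class → Set₁
Dominates C D = ∀ (P : Formula → Set) → BoundedOn D P → BoundedOn C P

StrictlyDominates : Class → Class → Set₁
StrictlyDominates C D = Dominates C D × ¬ Dominates D C

data BaseClass : Set where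
  horn dhorn krom : BaseClass

⟦_⟧ : BaseClass → Class
⟦ horn ⟧ = Horn
⟦ dhorn ⟧ = dHorn
⟦ krom ⟧ = Krom

-- Since Null ⊆ C and C is decidable, a Null decision tree is also a C decision tree (one that
-- may stop earlier), so depth_C ≤ depth_Null. Conversely, the formula of all 2-clauses of one
-- sign (negative for Horn, positive for dHorn and Krom) over n variables lies in C, but its
-- Null-depth is at least n − 1: branching on a variable removes one vertex of the clique,
-- splitting into components only discards empty clauses, and a clique on two or more
-- vertices is not variable-free.
module Submission where

open import Defs
open import Data.Bool using (Bool; true; false; T)
open import Data.Empty using (⊥-elim)
open import Data.Fin using (Fin; zero; suc; toℕ; punchIn; punchOut; _≟_)
open import Data.Fin.Properties using (toℕ-injective; punchIn-injective; punchInᵢ≢i; punchIn-punchOut)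
open import Data.List using (List; []; _∷_; length; allFin; cartesianProduct; filter; map)
open import Data.List.Membership.Propositional using (_∈_; _∉_; find)
open import Data.List.Membership.Propositional.Properties
  using (∈-concatMap⁻; ∈-filter⁺; ∈-filter⁻; ∈-map⁺; ∈-map⁻; ∈-cartesianProduct⁺; ∈-allFin)
open import Data.List.Relation.Unary.All as All using (All; []; _∷_; all?)
open import Data.List.Relation.Unary.AllPairs using ([]; _∷_)
open import Data.List.Relation.Unary.Any using (here; there)
open import Data.Nat as ℕ using (ℕ; zero; suc; _≤_; _≡ᵇ_; z≤n; s≤s; _≤?_)
open import Data.Nat.Properties using (≡⇒≡ᵇ; ≤-refl; 1+n≰n)
open import Data.Product using (∃; _×_; _,_; proj₁; proj₂)
open import Function using (_∘_)
open import Function.Bundles using (mk⇔)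
open import Function.Definitions using (Injective)
open import Relation.Binary.Construct.Closure.ReflexiveTransitive as Star using (_◅_)
open import Relation.Binary.PropositionalEquality using (_≡_; _≢_; refl; sym; trans; cong; subst)
open import Relation.Nullary using (¬_; Dec; yes; no; ¬?)
open import Relation.Nullary.Decidable using (dec-false)
open import Relation.Unary using (_⊆_; Decidable)

Depth≤-⊆ : ∀ {C D : Class} {k F} → C ⊆ D → Decidable D → Depth≤ C k F → Depth≤ D k F
Depth≤-⊆ C⊆D D? (base c) = base (C⊆D c)
Depth≤-⊆ {F = F} C⊆D D? (branch x _ conn x∈F d₀ d₁) with D? F
... | yes d = base d
... | no ¬d = branch x ¬d conn x∈F (Depth≤-⊆ C⊆D D? d₀) (Depth≤-⊆ C⊆D D? d₁)
Depth≤-⊆ {F = F} C⊆D D? (split _ ¬conn components) with D? F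
... | yes d = base d
... | no ¬d = split ¬d ¬conn (λ G G∈F → Depth≤-⊆ C⊆D D? (components G G∈F))

Dominates-⊆ : ∀ {C D : Class} → C ⊆ D → Decidable D → Dominates D C
Dominates-⊆ C⊆D D? P (k , bound) = k , λ F wf p → Depth≤-⊆ C⊆D D? (bound F wf p)

Null⊆⟦_⟧ : ∀ b → Null ⊆ ⟦ b ⟧
Null⊆⟦ horn ⟧  = All.map λ { refl → z≤n }
Null⊆⟦ dhorn ⟧ = All.map λ { refl → z≤n }
Null⊆⟦ krom ⟧  = All.map λ { refl → z≤n }

⟦_⟧? : ∀ b → Decidable ⟦ b ⟧
⟦ horn ⟧?  = all? λ c → countPos c ≤? 1
⟦ dhorn ⟧? = all? λ c → countNeg c ≤? 1
⟦ krom ⟧?  = all? λ c → length c ≤? 2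

≢⇒≡ᵇ-false : ∀ {m n} → m ≢ n → (m ≡ᵇ n) ≡ false
≢⇒≡ᵇ-false {m} {n} = dec-false (m ℕ.≟ n)

≡ᵇ-false⇒≢ : ∀ {m n} → (m ≡ᵇ n) ≡ false → m ≢ n
≡ᵇ-false⇒≢ {m} m≢ᵇm refl = subst T m≢ᵇm (≡⇒≡ᵇ m m refl)

satisfiedBy-∉ : ∀ {x ε} c → x ∉ varsC c → satisfiedBy x ε c ≡ false
satisfiedBy-∉ [] _ = refl
satisfiedBy-∉ (l ∷ c) x∉ rewrite ≢⇒≡ᵇ-false (x∉ ∘ here ∘ sym) = satisfiedBy-∉ c (x∉ ∘ there)

dropVar-∉ : ∀ {x} c → x ∉ varsC c → dropVar x c ≡ c
dropVar-∉ [] _ = refl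
dropVar-∉ (l ∷ c) x∉ rewrite ≢⇒≡ᵇ-false (x∉ ∘ here ∘ sym) = cong (l ∷_) (dropVar-∉ c (x∉ ∘ there))

varsC-dropVar⁻ : ∀ {x y} c → y ∈ varsC (dropVar x c) → y ∈ varsC c × y ≢ x
varsC-dropVar⁻ {x} (l ∷ c) y∈ with var l ≡ᵇ x in eq
... | true = let (y∈c , y≢x) = varsC-dropVar⁻ c y∈ in there y∈c , y≢x
varsC-dropVar⁻ {x} (l ∷ c) (here refl) | false = here refl , ≡ᵇ-false⇒≢ eq
varsC-dropVar⁻ {x} (l ∷ c) (there y∈) | false = let (y∈c , y≢x) = varsC-dropVar⁻ c y∈ in there y∈c , y≢x

restrict-∉ : ∀ {x ε c} F → c ∈ F → x ∉ varsC c → c ∈ F [ x ≔ ε ]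
restrict-∉ {x} {ε} (c ∷ F) (here refl) x∉c
  rewrite satisfiedBy-∉ {ε = ε} c x∉c | dropVar-∉ c x∉c = here refl
restrict-∉ {x} {ε} (d ∷ F) (there c∈F) x∉c with satisfiedBy x ε d
... | true  = restrict-∉ F c∈F x∉c
... | false = there (restrict-∉ F c∈F x∉c)

restrict-∈⁻ : ∀ {x ε d} F → d ∈ F [ x ≔ ε ] → ∃ λ c → c ∈ F × d ≡ dropVar x c
restrict-∈⁻ {x} {ε} (c ∷ F) d∈ with satisfiedBy x ε c | d∈
... | true  | d∈F′       = let (c′ , c′∈F , eq) = restrict-∈⁻ F d∈F′ in c′ , there c′∈F , eq
... | false | here refl  = c , here refl , refl
... | false | there d∈F′ = let (c′ , c′∈F , eq) = restrict-∈⁻ F d∈F′ in c′ , there c′∈F , eq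

varsC-restrict⁻ : ∀ {x ε d y} F → d ∈ F [ x ≔ ε ] → y ∈ varsC d →
                  (∃ λ c → c ∈ F × y ∈ varsC c) × y ≢ x
varsC-restrict⁻ F d∈ y∈d with restrict-∈⁻ F d∈
... | c , c∈F , refl = let (y∈c , y≢x) = varsC-dropVar⁻ c y∈d in (c , c∈F , y∈c) , y≢x

pairClause : Bool → ℕ → ℕ → Clause
pairClause s i j = lit i s ∷ lit j s ∷ []

∉-pairClause : ∀ {s i j x} → i ≢ x → j ≢ x → x ∉ varsC (pairClause s i j)
∉-pairClause i≢x _   (here x≡i)         = i≢x (sym x≡i)
∉-pairClause _   j≢x (there (here x≡j)) = j≢x (sym x≡j)

record Clique (s : Bool) {n} (f : Fin n → ℕ) (F : Formula) : Set where
  field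
    injective : Injective _≡_ _≡_ f
    pair∈     : ∀ {i j} → i ≢ j → pairClause s (f i) (f j) ∈ F
    var∈      : ∀ {c y} → c ∈ F → y ∈ varsC c → ∃ λ i → f i ≡ y

Clique-restrict : ∀ {s n F ε} {f : Fin (suc n) → ℕ} → Clique s f F →
                  (i : Fin (suc n)) → Clique s (f ∘ punchIn i) (F [ f i ≔ ε ])
Clique-restrict {s} {F = F} {f = f} K i = record
  { injective = punchIn-injective i _ _ ∘ injective
  ; pair∈     = λ j≢k → restrict-∉ F (pair∈ (j≢k ∘ punchIn-injective i _ _))
                                       (∉-pairClause {s} (avoids _) (avoids _))
  ; var∈      = λ d∈ y∈d → preimage (varsC-restrict⁻ F d∈ y∈d)
  }
  where
  open Clique K
  avoids : ∀ j → f (punchIn i j) ≢ f i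
  avoids j = punchInᵢ≢i i j ∘ injective
  preimage : ∀ {y} → (∃ λ c → c ∈ F × y ∈ varsC c) × y ≢ f i → ∃ λ j → f (punchIn i j) ≡ y
  preimage ((c , c∈F , y∈c) , y≢fi) with var∈ c∈F y∈c
  ... | j , refl = punchOut i≢j , cong f (punchIn-punchOut i≢j)
    where i≢j = y≢fi ∘ cong f ∘ sym

Clique⇒¬Null : ∀ {s n F} {f : Fin (suc (suc n)) → ℕ} → Clique s f F → ¬ Null F
Clique⇒¬Null K null with All.lookup null (Clique.pair∈ K {zero} {suc zero} λ ())
... | ()

nonEmpty? : (c : Clause) → Dec (c ≢ [])
nonEmpty? []      = no λ []≢[] → []≢[] refl
nonEmpty? (_ ∷ _) = yes λ ()

nonEmptyClauses : Formula → Formula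
nonEmptyClauses = filter nonEmpty?

∈-nonEmptyClauses⁻ : ∀ {c} F → c ∈ nonEmptyClauses F → c ∈ F × c ≢ []
∈-nonEmptyClauses⁻ F = ∈-filter⁻ nonEmpty? {xs = F}

∈-nonEmptyClauses⁺ : ∀ {c F} → c ∈ F → c ≢ [] → c ∈ nonEmptyClauses F
∈-nonEmptyClauses⁺ = ∈-filter⁺ nonEmpty?

Reach-≢[] : ∀ {F c d} → Reach F c d → c ≢ [] → d ≢ []
Reach-≢[] Star.ε                       c≢[] = c≢[]
Reach-≢[] ((_ , _ , _ , _ , y∈d) ◅ steps) _    = Reach-≢[] steps (∈varsC⇒≢[] y∈d)
  where
  ∈varsC⇒≢[] : ∀ {y c} → y ∈ varsC c → c ≢ []
  ∈varsC⇒≢[] {c = _ ∷ _} _ ()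

Clique-nonEmptyClauses : ∀ {s n F} {f : Fin n → ℕ} → Clique s f F → Clique s f (nonEmptyClauses F)
Clique-nonEmptyClauses {F = F} K = record
  { injective = injective
  ; pair∈     = λ i≢j → ∈-nonEmptyClauses⁺ (pair∈ i≢j) λ ()
  ; var∈      = var∈ ∘ proj₁ ∘ ∈-nonEmptyClauses⁻ F
  }
  where open Clique K

-- A non-empty clause contains some f j and so is joined to c₀ directly or through pairClause (f 0) (f j).
nonEmptyClauses-component : ∀ {s n F} {f : Fin (suc (suc n)) → ℕ} → Clique s f F →
                            IsComponent F (nonEmptyClauses F)
nonEmptyClauses-component {s} {F = F} {f} K = c₀ , c₀∈F , λ d → mk⇔ (reachable d) (nonEmpty d)
  where
  open Clique K
  c₀ : Clause
  c₀ = pairClause s (f zero) (f (suc zero))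
  c₀∈F : c₀ ∈ F
  c₀∈F = pair∈ λ ()
  reachable : ∀ d → d ∈ nonEmptyClauses F → d ∈ F × Reach F c₀ d
  reachable d d∈ with ∈-nonEmptyClauses⁻ F d∈
  reachable []      d∈ | _ , []≢[] = ⊥-elim ([]≢[] refl)
  reachable (_ ∷ _) d∈ | d∈F , _ with var∈ d∈F (here refl)
  ... | zero , f0≡l = d∈F , (c₀∈F , d∈F , f zero , here refl , here f0≡l) ◅ Star.ε
  ... | suc j , fj≡l = d∈F , (c₀∈F , e∈F , f zero , here refl , here refl)
                           ◅ (e∈F , d∈F , f (suc j) , there (here refl) , here fj≡l) ◅ Star.ε
    where
    e∈F : pairClause s (f zero) (f (suc j)) ∈ F
    e∈F = pair∈ λ ()
  nonEmpty : ∀ d → d ∈ F × Reach F c₀ d → d ∈ nonEmptyClauses F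
  nonEmpty d (d∈F , c₀⇝d) = ∈-nonEmptyClauses⁺ d∈F (Reach-≢[] c₀⇝d λ ())

∈-vars⁻ : ∀ {x} F → x ∈ vars F → ∃ λ c → c ∈ F × x ∈ varsC c
∈-vars⁻ F x∈F = find (∈-concatMap⁻ varsC {xs = F} x∈F)

Clique-depth : ∀ {s n k F} {f : Fin n → ℕ} → Clique s f F → Depth≤ Null k F → n ≤ suc k
Clique-depth {n = zero}        _ _ = z≤n
Clique-depth {n = suc zero}    _ _ = s≤s z≤n
Clique-depth {n = suc (suc n)} K (base null) = ⊥-elim (Clique⇒¬Null K null)
Clique-depth {n = suc (suc n)} {F = F} K (branch x _ _ x∈F d₀ _) with ∈-vars⁻ F x∈F
... | c , c∈F , x∈c with Clique.var∈ K c∈F x∈c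
...   | i , refl = s≤s (Clique-depth (Clique-restrict K i) d₀)
Clique-depth {n = suc (suc n)} K (split _ _ components) =
  Clique-depth (Clique-nonEmptyClauses K) (components _ (nonEmptyClauses-component K))

Distinct : ∀ {n} → Fin n × Fin n → Set
Distinct (i , j) = i ≢ j

distinct? : ∀ {n} → Decidable (Distinct {n})
distinct? (i , j) = ¬? (i ≟ j)

distinctPairs : ∀ n → List (Fin n × Fin n)
distinctPairs n = filter distinct? (cartesianProduct (allFin n) (allFin n))

completeFormula : Bool → ℕ → Formula
completeFormula s n = map (λ (i , j) → pairClause s (toℕ i) (toℕ j)) (distinctPairs n)

∈-completeFormula⁻ : ∀ {s n c} → c ∈ completeFormula s n →
                     ∃ λ (i : Fin n) → ∃ λ j → i ≢ j × c ≡ pairClause s (toℕ i) (toℕ j)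
∈-completeFormula⁻ {n = n} c∈ with ∈-map⁻ _ c∈
... | (i , j) , ij∈ , refl =
  i , j , proj₂ (∈-filter⁻ distinct? {xs = cartesianProduct (allFin n) (allFin n)} ij∈) , refl

Clique-completeFormula : ∀ s n → Clique s toℕ (completeFormula s n)
Clique-completeFormula s n = record
  { injective = toℕ-injective
  ; pair∈     = λ {i} {j} i≢j →
      ∈-map⁺ _ (∈-filter⁺ distinct? (∈-cartesianProduct⁺ (∈-allFin i) (∈-allFin j)) i≢j)
  ; var∈      = var∈
  }
  where
  var∈ : ∀ {c y} → c ∈ completeFormula s n → y ∈ varsC c → ∃ λ i → toℕ i ≡ y
  var∈ c∈ y∈c with ∈-completeFormula⁻ {n = n} c∈
  ... | i , j , _ , refl with y∈c
  ...   | here refl         = i , refl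
  ...   | there (here refl) = j , refl

pairClause-WF : ∀ {s i j} → i ≢ j → WFClause (pairClause s i j)
pairClause-WF {s} {i} {j} i≢j = ((i≢j ∘ cong var) ∷ []) ∷ [] ∷ [] , noComplement
  where
  sign≡s : ∀ {x b} → lit x b ∈ pairClause s i j → b ≡ s
  sign≡s (here refl)         = refl
  sign≡s (there (here refl)) = refl
  noComplement : NoComplementaryPair (pairClause s i j)
  noComplement x (pos , neg) with trans (sign≡s pos) (sym (sign≡s neg))
  ... | ()

IsPairClause : Bool → Clause → Set
IsPairClause s c = ∃ λ i → ∃ λ j → i ≢ j × c ≡ pairClause s i j

completeFormula-pairClauses : ∀ s n → All (IsPairClause s) (completeFormula s n)
completeFormula-pairClauses s n = All.tabulate λ c∈ →
  let (i , j , i≢j , c≡) = ∈-completeFormula⁻ {n = n} c∈ in toℕ i , toℕ j , i≢j ∘ toℕ-injective , c≡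

pairClauses-WF : ∀ {s F} → All (IsPairClause s) F → WF F
pairClauses-WF = All.map λ { (_ , _ , i≢j , refl) → pairClause-WF i≢j }

cliqueSign : BaseClass → Bool
cliqueSign horn  = false
cliqueSign dhorn = true
cliqueSign krom  = true

pairClauses-∈⟦_⟧ : ∀ b {F} → All (IsPairClause (cliqueSign b)) F → ⟦ b ⟧ F
pairClauses-∈⟦ horn ⟧  = All.map λ { (_ , _ , _ , refl) → z≤n }
pairClauses-∈⟦ dhorn ⟧ = All.map λ { (_ , _ , _ , refl) → z≤n }
pairClauses-∈⟦ krom ⟧  = All.map λ { (_ , _ , _ , refl) → ≤-refl }

completeFormula-depth : ∀ {s n k} → Depth≤ Null k (completeFormula s n) → n ≤ suc k
completeFormula-depth {s} {n} = Clique-depth (Clique-completeFormula s n)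

mainTheorem14 : (b : BaseClass) → StrictlyDominates ⟦ b ⟧ Null
mainTheorem14 b = Dominates-⊆ Null⊆⟦ b ⟧ ⟦ b ⟧? , ¬Null-dominates
  where
  ¬Null-dominates : ¬ Dominates Null ⟦ b ⟧
  ¬Null-dominates dom with dom ⟦ b ⟧ (0 , λ _ _ → base)
  ... | k , bounded =
    1+n≰n (completeFormula-depth (bounded _ (pairClauses-WF shape) (pairClauses-∈⟦ b ⟧ shape)))
    where
    shape : All (IsPairClause (cliqueSign b)) (completeFormula (cliqueSign b) (suc (suc k)))
    shape = completeFormula-pairClauses (cliqueSign b) (suc (suc k))
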